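{- Let $a, b$ be positive integers and let $(P_i, A_i, B_i)_{i=1}^a$ be an $(a,b)$-path system in a directed graph $G$. Then for all $i, j \in [a]$ there exist a linkage $\mathcal{L}_{i,j}$ from $B_i$ to $A_j$ and a walk $W_{i,j}$ such that $(W_{i,j}, \mathcal{L}_{i,j})$ is a threaded linkage of size $b$ and overlap at most $3$.
   Context: A walk is a sequence of vertices with consecutive vertices joined by arcs. The number of occurrences $\mathrm{oc}(v,W)$ of $v$ in $W$ is the number of times $v$ appears in the sequence (for a closed walk, minus one for its starting vertex). The overlap of a walk $W$ is $\max_v \mathrm{oc}(v,W)$. A set $X \subseteq V(G)$ is well-linked if for all $A, B \subseteq X$ with $|A| = |B|$ there are $|A|$ vertex-disjoint $A$-$B$ paths in $G - (X \setminus (A \cup B))$. An $(a,b)$-path system consists of vertex-disjoint paths $P_1, \dots, P_a$ and sets $A_i, B_i \subseteq V(P_i)$ of size $b$ with every vertex of $B_i$ appearing on $P_i$ after all vertices of $A_i$, such that $\bigcup_i (A_i \cup B_i)$ is well-linked. A linkage from $A$ to $B$ ($|A|=|B|$) is a set of $|A|$ pairwise vertex-disjoint paths each starting in $A$ and ending in $B$. A threaded linkage is a pair $(W, \mathcal{L})$ where $\mathcal{L} = \{L_1, \dots, L_\ell\}$ is a linkage and there exist paths $Q_1, \dots, Q_{\ell-1}$ (threads) such that $W$ is the concatenation $L_1, Q_1, L_2, Q_2, \dots, Q_{\ell-1}, L_\ell$. Its size is $|\mathcal{L}|$ and its overlap is the overlap of $W$. -}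

module Defs where

open import Data.Nat using (ℕ; zero; suc; _∸_; _≤_)
open import Data.Fin using (Fin; _≟_)
import Data.Fin.Subset
open Data.Fin.Subset using (Subset; _∈_; _∉_; _∪_; _─_; _⊆_; ⋃; ∣_∣)
open import Data.List using (List; []; _∷_; _++_; length; head; last; tail; map; allFin)
open import Data.List.Membership.Propositional using () renaming (_∈_ to _∈ₗ_)
open import Data.List.Relation.Unary.All using (All)
open import Data.List.Relation.Unary.AllPairs using (AllPairs)
open import Data.List.Relation.Unary.Unique.Propositional using (Unique)
open import Data.Maybe using (Maybe; just; nothing)
open import Data.Product using (Σ; ∃; ∃-syntax; _×_; _,_)
open import Relation.Binary.PropositionalEquality using (_≡_)
open import Relation.Nullary using (¬_; yes; no)
open import Data.Unit using (⊤)
open import Data.Empty using (⊥)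

tail′ : ∀ {n} → List (Fin n) → List (Fin n)
tail′ []       = []
tail′ (_ ∷ xs) = xs

Digraph : ℕ → Set₁
Digraph n = Fin n → Fin n → Set

module _ {n : ℕ} (E : Digraph n) where

  Consecutive : List (Fin n) → Set
  Consecutive []           = ⊤
  Consecutive (x ∷ [])     = ⊤
  Consecutive (x ∷ y ∷ xs) = E x y × Consecutive (y ∷ xs)

  IsWalk : List (Fin n) → Set
  IsWalk []       = ⊥
  IsWalk (x ∷ xs) = Consecutive (x ∷ xs)

  IsPath : List (Fin n) → Set
  IsPath P = IsWalk P × Unique P

  IsPathAvoiding : Subset n → List (Fin n) → Set
  IsPathAvoiding S P = IsPath P × All (_∉ S) P

  Disjoint : List (Fin n) → List (Fin n) → Set
  Disjoint P Q = ∀ {v} → v ∈ₗ P → ¬ (v ∈ₗ Q)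

  StartsIn : Subset n → List (Fin n) → Set
  StartsIn A P = ∃[ v ] (head P ≡ just v × v ∈ A)

  EndsIn : Subset n → List (Fin n) → Set
  EndsIn B P = ∃[ v ] (last P ≡ just v × v ∈ B)

  IsLinkageAvoiding : Subset n → Subset n → Subset n → List (List (Fin n)) → Set
  IsLinkageAvoiding S A B 𝓛 =
    ∣ A ∣ ≡ ∣ B ∣ × length 𝓛 ≡ ∣ A ∣ ×
    All (λ P → IsPathAvoiding S P × StartsIn A P × EndsIn B P) 𝓛 ×
    AllPairs Disjoint 𝓛

  IsLinkage : Subset n → Subset n → List (List (Fin n)) → Set
  IsLinkage A B 𝓛 = IsLinkageAvoiding Data.Fin.Subset.⊥ A B 𝓛

  WellLinked : Subset n → Set
  WellLinked X = ∀ (A B : Subset n) → A ⊆ X → B ⊆ X → ∣ A ∣ ≡ ∣ B ∣ →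
    ∃[ 𝓛 ] IsLinkageAvoiding (X ─ (A ∪ B)) A B 𝓛

  IsPathSystem : (a b : ℕ) → (Fin a → List (Fin n)) → (Fin a → Subset n) → (Fin a → Subset n) → Set
  IsPathSystem a b P A B =
    (∀ i → IsPath (P i)) ×
    (∀ i j → ¬ (i ≡ j) → Disjoint (P i) (P j)) ×
    (∀ i → ∣ A i ∣ ≡ b × ∣ B i ∣ ≡ b) ×
    -- A_i, B_i ⊆ V(P_i) and every vertex of B_i appears on P_i after all vertices of A_i
    (∀ i → ∃[ pre ] ∃[ post ] (P i ≡ pre ++ post ×
                                (∀ v → v ∈ A i → v ∈ₗ pre) ×
                                (∀ v → v ∈ B i → v ∈ₗ post))) ×
    WellLinked (⋃ (map (λ i → A i ∪ B i) (allFin a)))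

  -- (W, 𝓛) is a threaded linkage: W = L₁ Q₁ L₂ Q₂ … Q_{ℓ-1} L_ℓ for some paths Q_k
  -- (thread Q_k runs from the last vertex of L_k to the first vertex of L_{k+1};
  -- shared endpoints are written once in the concatenated sequence)
  data Threaded : List (List (Fin n)) → List (Fin n) → Set where
    one  : ∀ L → Threaded (L ∷ []) L
    cons : ∀ L Q L′ 𝓛 W → IsPath Q → last L ≡ head Q → last Q ≡ head L′ →
           Threaded (L′ ∷ 𝓛) W → Threaded (L ∷ L′ ∷ 𝓛) (L ++ tail′ Q ++ tail′ W)

  IsThreadedLinkage : List (Fin n) → List (List (Fin n)) → Set
  IsThreadedLinkage W 𝓛 = IsWalk W × Threaded 𝓛 W

count : ∀ {n} → Fin n → List (Fin n) → ℕ
count v []       = 0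
count v (x ∷ xs) with x ≟ v
... | yes _ = suc (count v xs)
... | no  _ = count v xs

IsClosed : ∀ {n} → List (Fin n) → Set
IsClosed []           = ⊥
IsClosed (x ∷ [])     = ⊥
IsClosed (x ∷ y ∷ xs) = last (y ∷ xs) ≡ just x

-- oc(v, W) ≤ k, with the convention that for a closed walk the starting vertex
-- is counted once less
OccAtMost : ∀ {n} → ℕ → Fin n → List (Fin n) → Set
OccAtMost k v W = (IsClosed W → head W ≡ just v → count v W ∸ 1 ≤ k)
                × (¬ (IsClosed W × head W ≡ just v) → count v W ≤ k)

OverlapAtMost : ∀ {n} → ℕ → List (Fin n) → Set
OverlapAtMost {n} k W = ∀ (v : Fin n) → OccAtMost k v W

{-# OPTIONS --safe #-}
-- The well-linked set gives a linkage L from B_i to A_j and a linkage M back from A_j to B_i.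
-- Both consist of b = |B_i| = |A_j| paths, so every vertex of B_i starts a path of L and every
-- vertex of A_j starts a path of M. Hence following a path of M, then the path of L starting at its
-- end, leads to the start of another path of M; this permutes M. The paths of L are visited along
-- the cycles of this permutation, each thread being the next path of M. When a cycle closes, the
-- thread first runs forward along P_j (which contains A_j) to the unvisited path of M starting
-- earliest on P_j; as cycles are started in this order, these pieces of P_j do not overlap. Loop
-- erasure turns each thread into a path. A vertex then occurs at most once on L, once on M and once
-- on the pieces of P_j, so the overlap is at most 3.
module Submission where

open import Data.Empty using (⊥-elim)
open import Data.Fin using (Fin; zero; suc; _≟_; toℕ; fromℕ<)
open import Data.Fin.Properties using (0≢1+n; injective⇒≤; suc-injective; any?)
open import Data.Fin.Subset using (Subset; _∈_; _-_; _─_; ∣_∣; _∪_; ⋃; _⊆_)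
open import Data.Fin.Subset.Properties using (x∈p∧x≢y⇒x∈p-y; x∈p⇒∣p-x∣<∣p∣; ∉⊥; p⊆p∪q; q⊆p∪q)
open import Data.List using (List; []; _∷_; _++_; length; head; last; map; take; drop; lookup; allFin)
open import Data.List.Properties using (drop-drop; take++drop≡id; ++-identityʳ; length-map)
open import Data.List.Membership.Propositional using () renaming (_∈_ to _∈ₗ_; _∉_ to _∉ₗ_)
open import Data.List.Membership.Propositional.Properties
  using (∈-map⁺; ∈-allFin; ∈-lookup; ∈-++⁺ˡ; ∈-++⁺ʳ; ∈-++⁻)
import Data.List.Relation.Unary.All as All
open All using (All; []; _∷_)
open import Data.List.Relation.Unary.All.Properties using (¬Any⇒All¬) renaming (map⁺ to All-map⁺)
import Data.List.Relation.Unary.AllPairs as AllPairs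
open AllPairs using (AllPairs; []; _∷_)
import Data.List.Relation.Unary.AllPairs.Properties as AllPairs
open import Data.List.Relation.Unary.Any using (here; there; index)
open import Data.List.Relation.Unary.Any.Properties using (lookup-index)
open import Data.List.Relation.Unary.Linked using (Linked; []; [-]; _∷_)
open import Data.List.Relation.Unary.Unique.Propositional using (Unique)
open import Data.List.Relation.Unary.Unique.Propositional.Properties using (Unique[x∷xs]⇒x∉xs)
  renaming (drop⁺ to Unique-drop⁺)
open import Data.Maybe using (just)
open import Data.Nat using (ℕ; zero; suc; _+_; _∸_; _≤_; _<_; z≤n; s≤s)
open import Data.Nat.ListAction using (sum)
open import Data.Nat.Properties hiding (_≟_; suc-injective; 0≢1+n)
open import Algebra.Properties.CommutativeSemigroup +-commutativeSemigroup using (interchange)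
open import Data.Product using (∃; ∃-syntax; _×_; _,_; proj₁; proj₂)
open import Data.Sum using (_⊎_; inj₁; inj₂; [_,_]′)
open import Data.Unit using (⊤; tt)
open import Function using (_∘′_; id)
open import Function.Definitions using (Injective)
open import Relation.Binary.Definitions using (Symmetric)
open import Relation.Binary.PropositionalEquality
open import Relation.Nullary using (¬_; ¬?; yes; no)
open import Relation.Nullary.Decidable using (decidable-stable)
open import Relation.Unary using (Decidable)

open import Defs

module _ {n : ℕ} where

  private
    V = Fin n

  count-++ : ∀ (v : V) xs ys → count v (xs ++ ys) ≡ count v xs + count v ys
  count-++ v []       ys = refl
  count-++ v (x ∷ xs) ys with x ≟ v
  ... | yes _ = cong suc (count-++ v xs ys)
  ... | no  _ = count-++ v xs ys

  count-∉ : ∀ {v : V} xs → v ∉ₗ xs → count v xs ≡ 0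
  count-∉ []       _  = refl
  count-∉ {v} (x ∷ xs) v∉ with x ≟ v
  ... | yes refl = ⊥-elim (v∉ (here refl))
  ... | no  _    = count-∉ xs (v∉ ∘′ there)

  Unique⇒count≤1 : ∀ (v : V) {xs} → Unique xs → count v xs ≤ 1
  Unique⇒count≤1 v {[]}     _          = z≤n
  Unique⇒count≤1 v {x ∷ xs} u@(_ ∷ u′) with x ≟ v
  ... | yes refl = s≤s (≤-reflexive (count-∉ xs (Unique[x∷xs]⇒x∉xs u)))
  ... | no  _    = Unique⇒count≤1 v u′

  count-tail′ : ∀ (v : V) xs → count v (tail′ xs) ≤ count v xs
  count-tail′ v []       = z≤n
  count-tail′ v (x ∷ xs) with x ≟ v
  ... | yes _ = n≤1+n _
  ... | no  _ = ≤-refl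

  count-∷-mono : ∀ v (x : V) {ys zs} → count v ys ≤ count v zs → count v (x ∷ ys) ≤ count v (x ∷ zs)
  count-∷-mono v x le with x ≟ v
  ... | yes _ = s≤s le
  ... | no  _ = le

  count-tail′-++ : ∀ (v : V) xs ys → count v (tail′ (xs ++ ys)) ≤ count v (tail′ xs) + count v ys
  count-tail′-++ v []       ys = count-tail′ v ys
  count-tail′-++ v (x ∷ xs) ys = ≤-reflexive (count-++ v xs ys)

  count-take-drop : ∀ (v : V) k xs → count v (take k xs) + count v (drop k xs) ≡ count v xs
  count-take-drop v k xs = trans (sym (count-++ v (take k xs) (drop k xs)))
                                 (cong (count v) (take++drop≡id k xs))

  count-drop : ∀ (v : V) k xs → count v (drop k xs) ≤ count v xs
  count-drop v k xs = ≤-trans (m≤n+m _ _) (≤-reflexive (count-take-drop v k xs))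

  count-drop-mono : ∀ (v : V) xs {c d} → c ≤ d → count v (drop d xs) ≤ count v (drop c xs)
  count-drop-mono v xs {c} {d} c≤d = begin
    count v (drop d xs)                 ≡⟨ cong (λ t → count v (drop t xs)) (m+[n∸m]≡n c≤d) ⟨
    count v (drop (c + (d ∸ c)) xs)     ≡⟨ cong (count v) (drop-drop c (d ∸ c) xs) ⟨
    count v (drop (d ∸ c) (drop c xs))  ≤⟨ count-drop v (d ∸ c) (drop c xs) ⟩
    count v (drop c xs)                 ∎
    where open ≤-Reasoning

  head-drop-index : ∀ {x : V} {xs} (x∈ : x ∈ₗ xs) → head (drop (toℕ (index x∈)) xs) ≡ just x
  head-drop-index (here refl) = refl
  head-drop-index (there x∈)  = head-drop-index x∈

  last-take-suc : ∀ k (xs : List V) {w} → head (drop k xs) ≡ just w → last (take (suc k) xs) ≡ just w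
  last-take-suc zero          (x ∷ xs)     refl = refl
  last-take-suc (suc k)       (x ∷ y ∷ ys) eq   = last-take-suc k (y ∷ ys) eq
  last-take-suc (suc zero)    (x ∷ [])     ()
  last-take-suc (suc (suc k)) (x ∷ [])     ()

  last-drop : ∀ k (xs : List V) {w} → head (drop k xs) ≡ just w → last (drop k xs) ≡ last xs
  last-drop zero          xs           _  = refl
  last-drop (suc k)       (x ∷ y ∷ ys) eq = last-drop k (y ∷ ys) eq
  last-drop (suc zero)    (x ∷ [])     ()
  last-drop (suc (suc k)) (x ∷ [])     ()

  head∈ : ∀ (xs : List V) {x} → head xs ≡ just x → x ∈ₗ xs
  head∈ (x ∷ xs) refl = here refl

  last∈ : ∀ (xs : List V) {x} → last xs ≡ just x → x ∈ₗ xs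
  last∈ (x ∷ [])     refl = here refl
  last∈ (x ∷ y ∷ xs) eq   = there (last∈ (y ∷ xs) eq)

  last-∷ : ∀ (x : V) {y ys} → y ∈ₗ ys → last (x ∷ ys) ≡ last ys
  last-∷ x {ys = _ ∷ _} _ = refl

  last-++-∷ : ∀ (xs : List V) y ys → last (xs ++ y ∷ ys) ≡ last (y ∷ ys)
  last-++-∷ []           y ys = refl
  last-++-∷ (x ∷ [])     y ys = refl
  last-++-∷ (x ∷ x′ ∷ xs) y ys = last-++-∷ (x′ ∷ xs) y ys

  last-++-tail′ : ∀ (xs ys : List V) → last xs ≡ head ys → last (xs ++ tail′ ys) ≡ last ys
  last-++-tail′ xs []           eq = trans (cong last (++-identityʳ xs)) eq
  last-++-tail′ xs (y ∷ [])     eq = trans (cong last (++-identityʳ xs)) eq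
  last-++-tail′ xs (y ∷ z ∷ zs) eq = last-++-∷ xs z zs

  tail′-take : ∀ k (xs : List V) → tail′ (take (suc k) xs) ≡ take k (tail′ xs)
  tail′-take zero    []       = refl
  tail′-take (suc k) []       = refl
  tail′-take k       (x ∷ xs) = refl

  tail′-drop : ∀ k (xs : List V) → tail′ (drop k xs) ≡ drop (suc k) xs
  tail′-drop zero    []       = refl
  tail′-drop zero    (x ∷ xs) = refl
  tail′-drop (suc k) []       = refl
  tail′-drop (suc k) (x ∷ xs) = tail′-drop k xs

module _ {n : ℕ} (E : Digraph n) where

  private
    V = Fin n

  Consecutive-tail′ : ∀ (xs : List V) → Consecutive E xs → Consecutive E (tail′ xs)
  Consecutive-tail′ []           _       = tt
  Consecutive-tail′ (x ∷ [])     _       = tt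
  Consecutive-tail′ (x ∷ y ∷ xs) (_ , c) = c

  Consecutive-drop : ∀ k (xs : List V) → Consecutive E xs → Consecutive E (drop k xs)
  Consecutive-drop zero    xs       c = c
  Consecutive-drop (suc k) []       c = c
  Consecutive-drop (suc k) (x ∷ xs) c = Consecutive-drop k xs (Consecutive-tail′ (x ∷ xs) c)

  Consecutive-take : ∀ k (xs : List V) → Consecutive E xs → Consecutive E (take k xs)
  Consecutive-take zero          xs           _       = tt
  Consecutive-take (suc k)       []           _       = tt
  Consecutive-take (suc zero)    (x ∷ xs)     _       = tt
  Consecutive-take (suc (suc k)) (x ∷ [])     _       = tt
  Consecutive-take (suc (suc k)) (x ∷ y ∷ xs) (e , c) = e , Consecutive-take (suc k) (y ∷ xs) c

  Consecutive-∷ : ∀ (x : V) xs ys → Consecutive E (x ∷ xs) → Consecutive E ys →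
                  head ys ≡ head xs → Consecutive E (x ∷ ys)
  Consecutive-∷ x xs       []       _       _ _    = tt
  Consecutive-∷ x (_ ∷ _)  (y ∷ ys) (e , _) c refl = e , c

  Consecutive-++-tail′ : ∀ (xs ys : List V) → Consecutive E xs → Consecutive E ys →
                         last xs ≡ head ys → Consecutive E (xs ++ tail′ ys)
  Consecutive-++-tail′ []            []       _       _ _    = tt
  Consecutive-++-tail′ (x ∷ [])      (y ∷ ys) _       c refl = c
  Consecutive-++-tail′ (x ∷ x′ ∷ xs) ys       (e , c) c′ eq  =
    e , Consecutive-++-tail′ (x′ ∷ xs) ys c c′ eq

  Consecutive⇒IsWalk : ∀ (xs : List V) {x} → Consecutive E xs → head xs ≡ just x → IsWalk E xs
  Consecutive⇒IsWalk (x ∷ xs) c _ = c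

  IsWalk⇒Consecutive : ∀ (xs : List V) → IsWalk E xs → Consecutive E xs
  IsWalk⇒Consecutive (x ∷ xs) w = w

  IsWalk-++-tail′ : ∀ (xs ys : List V) → IsWalk E xs → IsWalk E ys → last xs ≡ head ys →
                    IsWalk E (xs ++ tail′ ys)
  IsWalk-++-tail′ (x ∷ xs) ys wx wy eq =
    Consecutive-++-tail′ (x ∷ xs) ys wx (IsWalk⇒Consecutive ys wy) eq

  IsWalk-head-++ : ∀ (xs ys : List V) → IsWalk E xs → head (xs ++ ys) ≡ head xs
  IsWalk-head-++ (x ∷ xs) ys _ = refl

module _ {n : ℕ} where

  private
    V = Fin n

  open import Data.List.Membership.DecPropositional (_≟_ {n}) using (_∈?_)

  -- Prepends x to p, erasing the closed walk from x to its occurrence on p, if any.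
  _◁_ : V → List V → List V
  x ◁ p with x ∈? p
  ... | yes x∈p = drop (toℕ (index x∈p)) p
  ... | no  _   = x ∷ p

  loopErase : List V → List V
  loopErase []       = []
  loopErase (x ∷ xs) = x ◁ loopErase xs

  ◁-head : ∀ x p → head (x ◁ p) ≡ just x
  ◁-head x p with x ∈? p
  ... | yes x∈p = head-drop-index x∈p
  ... | no  _   = refl

  ◁-last : ∀ x p → last (x ◁ p) ≡ last (x ∷ p)
  ◁-last x p with x ∈? p
  ... | yes x∈p = trans (last-drop (toℕ (index x∈p)) p (head-drop-index x∈p)) (sym (last-∷ x x∈p))
  ... | no  _   = refl

  ◁-unique : ∀ x {p} → Unique p → Unique (x ◁ p)
  ◁-unique x {p} u with x ∈? p
  ... | yes x∈p = Unique-drop⁺ (toℕ (index x∈p)) u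
  ... | no  x∉p = ¬Any⇒All¬ p x∉p ∷ u

  ◁-consecutive : ∀ (E : Digraph n) x p → Consecutive E (x ∷ p) → Consecutive E (x ◁ p)
  ◁-consecutive E x p c with x ∈? p
  ... | yes x∈p = Consecutive-drop E (toℕ (index x∈p)) p (Consecutive-tail′ E (x ∷ p) c)
  ... | no  _   = c

  ◁-count : ∀ v x p → count v (x ◁ p) ≤ count v (x ∷ p)
  ◁-count v x p with x ∈? p
  ... | yes x∈p = ≤-trans (count-drop v (toℕ (index x∈p)) p) (count-tail′ v (x ∷ p))
  ... | no  _   = ≤-refl

  ◁-count-tail′ : ∀ v x p → count v (tail′ (x ◁ p)) ≤ count v p
  ◁-count-tail′ v x p with x ∈? p
  ... | yes x∈p = ≤-trans (≤-reflexive (cong (count v) (tail′-drop (toℕ (index x∈p)) p)))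
                          (count-drop v (suc (toℕ (index x∈p))) p)
  ... | no  _   = ≤-refl

  loopErase-head : ∀ xs → head (loopErase xs) ≡ head xs
  loopErase-head []       = refl
  loopErase-head (x ∷ xs) = ◁-head x (loopErase xs)

  loopErase-last : ∀ xs → last (loopErase xs) ≡ last xs
  loopErase-last []           = refl
  loopErase-last (x ∷ [])     = ◁-last x []
  loopErase-last (x ∷ y ∷ ys) = begin
    last (x ◁ loopErase (y ∷ ys))  ≡⟨ ◁-last x (loopErase (y ∷ ys)) ⟩
    last (x ∷ loopErase (y ∷ ys))  ≡⟨ last-∷ x (head∈ _ (loopErase-head (y ∷ ys))) ⟩
    last (loopErase (y ∷ ys))      ≡⟨ loopErase-last (y ∷ ys) ⟩
    last (y ∷ ys)                  ∎
    where open ≡-Reasoning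

  loopErase-unique : ∀ xs → Unique (loopErase xs)
  loopErase-unique []       = []
  loopErase-unique (x ∷ xs) = ◁-unique x (loopErase-unique xs)

  loopErase-consecutive : ∀ (E : Digraph n) xs → Consecutive E xs → Consecutive E (loopErase xs)
  loopErase-consecutive E []       _ = tt
  loopErase-consecutive E (x ∷ xs) c = ◁-consecutive E x (loopErase xs)
    (Consecutive-∷ E x xs (loopErase xs) c
      (loopErase-consecutive E xs (Consecutive-tail′ E (x ∷ xs) c)) (loopErase-head xs))

  loopErase-count : ∀ v xs → count v (loopErase xs) ≤ count v xs
  loopErase-count v []       = z≤n
  loopErase-count v (x ∷ xs) =
    ≤-trans (◁-count v x (loopErase xs)) (count-∷-mono v x (loopErase-count v xs))

  loopErase-count-tail′ : ∀ v xs → count v (tail′ (loopErase xs)) ≤ count v (tail′ xs)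
  loopErase-count-tail′ v []       = z≤n
  loopErase-count-tail′ v (x ∷ xs) = ≤-trans (◁-count-tail′ v x (loopErase xs)) (loopErase-count v xs)

-- (c , d) stands for the window of positions c + 1, …, d of a list. The nonempty windows start at
-- or after lo, each at or after the end of the previous one.
NonOverlappingFrom : ℕ → List (ℕ × ℕ) → Set
NonOverlappingFrom lo []            = ⊤
NonOverlappingFrom lo ((c , d) ∷ I) = (c ≡ d × NonOverlappingFrom lo I)
                                    ⊎ (lo ≤ c × c ≤ d × NonOverlappingFrom d I)

module _ {n : ℕ} (P : List (Fin n)) where

  private
    V = Fin n

  segment : ℕ → ℕ → List V
  segment c d = take (suc (d ∸ c)) (drop c P)

  segment-head : ∀ c d {u} → head (drop c P) ≡ just u → head (segment c d) ≡ just u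
  segment-head c d eq with drop c P
  segment-head c d refl | x ∷ _ = refl

  segment-last : ∀ {c d w} → c ≤ d → head (drop d P) ≡ just w → last (segment c d) ≡ just w
  segment-last {c} {d} {w} c≤d eq = last-take-suc (d ∸ c) (drop c P) (begin
    head (drop (d ∸ c) (drop c P))  ≡⟨ cong head (drop-drop c (d ∸ c) P) ⟩
    head (drop (c + (d ∸ c)) P)     ≡⟨ cong (λ t → head (drop t P)) (m+[n∸m]≡n c≤d) ⟩
    head (drop d P)                 ≡⟨ eq ⟩
    just w                          ∎)
    where open ≡-Reasoning

  segment-consecutive : ∀ (E : Digraph n) c d → Consecutive E P → Consecutive E (segment c d)
  segment-consecutive E c d p = Consecutive-take E (suc (d ∸ c)) _ (Consecutive-drop E c P p)

  tail′-segment : ∀ c d → tail′ (segment c d) ≡ take (d ∸ c) (drop (suc c) P)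
  tail′-segment c d = trans (tail′-take (d ∸ c) (drop c P)) (cong (take (d ∸ c)) (tail′-drop c P))

  windowCount : V → List (ℕ × ℕ) → ℕ
  windowCount v I = sum (map (λ (c , d) → count v (tail′ (segment c d))) I)

  windowCount-nonOverlapping : ∀ v lo I → NonOverlappingFrom lo I →
                               windowCount v I ≤ count v (drop (suc lo) P)
  windowCount-nonOverlapping v lo []            _ = z≤n
  windowCount-nonOverlapping v lo ((c , c) ∷ I) (inj₁ (refl , ch))
    rewrite tail′-segment c c | n∸n≡0 c = windowCount-nonOverlapping v lo I ch
  windowCount-nonOverlapping v lo ((c , d) ∷ I) (inj₂ (lo≤c , c≤d , ch))
    rewrite tail′-segment c d = begin
      count v (take (d ∸ c) X) + windowCount v I
        ≤⟨ +-monoʳ-≤ (count v (take (d ∸ c) X)) (windowCount-nonOverlapping v d I ch) ⟩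
      count v (take (d ∸ c) X) + count v (drop (suc d) P)
        ≡⟨ cong (λ t → count v (take (d ∸ c) X) + count v t) restAfterWindow ⟨
      count v (take (d ∸ c) X) + count v (drop (d ∸ c) X)
        ≡⟨ count-take-drop v (d ∸ c) X ⟩
      count v X
        ≤⟨ count-drop-mono v P (s≤s lo≤c) ⟩
      count v (drop (suc lo) P) ∎
    where
    open ≤-Reasoning
    X : List V
    X = drop (suc c) P
    restAfterWindow : drop (d ∸ c) X ≡ drop (suc d) P
    restAfterWindow = trans (drop-drop (suc c) (d ∸ c) P) (cong (λ t → drop (suc t) P) (m+[n∸m]≡n c≤d))

module ThreadedWalk {n m : ℕ} (E : Digraph n)
                    (F : Fin m → List (Fin n)) (Q : Fin m → Fin m → List (Fin n)) where

  private
    V = Fin n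

  weave : Fin m → List (Fin m) → List V
  weave y []        = F y
  weave y (y′ ∷ ys) = F y ++ tail′ (Q y y′) ++ tail′ (weave y′ ys)

  IsThread : Fin m → Fin m → Set
  IsThread y y′ = IsPath E (Q y y′) × last (F y) ≡ head (Q y y′) × last (Q y y′) ≡ head (F y′)

  weave-threaded : ∀ y ys → Linked IsThread (y ∷ ys) → Threaded E (map F (y ∷ ys)) (weave y ys)
  weave-threaded y []        _                    = one (F y)
  weave-threaded y (y′ ∷ ys) ((q , e₁ , e₂) ∷ ts) =
    cons (F y) (Q y y′) (F y′) (map F ys) (weave y′ ys) q e₁ e₂ (weave-threaded y′ ys ts)

  module _ (F-walk : ∀ y → IsWalk E (F y)) where

    weave-head : ∀ y ys → head (weave y ys) ≡ head (F y)
    weave-head y []        = refl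
    weave-head y (y′ ∷ ys) = IsWalk-head-++ E (F y) _ (F-walk y)

    weave-walk : ∀ y ys → Linked IsThread (y ∷ ys) → IsWalk E (weave y ys)
    weave-walk y []        _                          = F-walk y
    weave-walk y (y′ ∷ ys) (((wq , _) , e₁ , e₂) ∷ ts) = join (Q y y′) wq e₁
      (IsWalk-++-tail′ E (Q y y′) (weave y′ ys) wq (weave-walk y′ ys ts)
        (trans e₂ (sym (weave-head y′ ys))))
      where
      join : ∀ q → IsWalk E q → last (F y) ≡ head q → IsWalk E (q ++ tail′ (weave y′ ys)) →
             IsWalk E (F y ++ tail′ q ++ tail′ (weave y′ ys))
      join (q ∷ qs) _ e w = IsWalk-++-tail′ E (F y) (q ∷ qs ++ tail′ (weave y′ ys)) (F-walk y) w e

  threadCount : V → Fin m → List (Fin m) → ℕ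
  threadCount v y []        = 0
  threadCount v y (y′ ∷ ys) = count v (tail′ (Q y y′)) + threadCount v y′ ys

  weave-count : ∀ v y ys →
                count v (weave y ys) ≤ sum (map (λ z → count v (F z)) (y ∷ ys)) + threadCount v y ys
  weave-count v y []        = ≤-reflexive (sym (trans (+-identityʳ _) (+-identityʳ _)))
  weave-count v y (y′ ∷ ys) = begin
    count v (F y ++ tail′ (Q y y′) ++ tail′ (weave y′ ys))
      ≡⟨ count-++ v (F y) _ ⟩
    count v (F y) + count v (tail′ (Q y y′) ++ tail′ (weave y′ ys))
      ≡⟨ cong (count v (F y) +_) (count-++ v (tail′ (Q y y′)) _) ⟩
    count v (F y) + (count v (tail′ (Q y y′)) + count v (tail′ (weave y′ ys)))
      ≤⟨ +-monoʳ-≤ (count v (F y)) (+-monoʳ-≤ (count v (tail′ (Q y y′)))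
           (≤-trans (count-tail′ v (weave y′ ys)) (weave-count v y′ ys))) ⟩
    count v (F y) + (count v (tail′ (Q y y′)) + (Σ′ + threadCount v y′ ys))
      ≡⟨ +-assoc (count v (F y)) _ _ ⟨
    count v (F y) + count v (tail′ (Q y y′)) + (Σ′ + threadCount v y′ ys)
      ≡⟨ interchange (count v (F y)) _ Σ′ _ ⟩
    count v (F y) + Σ′ + (count v (tail′ (Q y y′)) + threadCount v y′ ys) ∎
    where
    open ≤-Reasoning
    Σ′ : ℕ
    Σ′ = sum (map (λ z → count v (F z)) (y′ ∷ ys))

module _ {a r} {A : Set a} {R : A → A → Set r} (R-sym : Symmetric R) where

  AllPairs-lookup : ∀ {xs} → AllPairs R xs → ∀ {i j} → i ≢ j → R (lookup xs i) (lookup xs j)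
  AllPairs-lookup (_ ∷ _)   {zero}  {zero}  i≢j = ⊥-elim (i≢j refl)
  AllPairs-lookup (px ∷ _)  {zero}  {suc j} _   = All.lookup px (∈-lookup j)
  AllPairs-lookup (px ∷ _)  {suc i} {zero}  _   = R-sym (All.lookup px (∈-lookup i))
  AllPairs-lookup (_ ∷ pxs) {suc i} {suc j} i≢j = AllPairs-lookup pxs (i≢j ∘′ cong suc)

Unique-lookup-injective : ∀ {m} {xs : List (Fin m)} → Unique xs → Injective _≡_ _≡_ (lookup xs)
Unique-lookup-injective u {i} {j} eq with i ≟ j
... | yes i≡j = i≡j
... | no  i≢j = ⊥-elim (AllPairs-lookup ≢-sym u i≢j eq)

Unique⇒length≤ : ∀ {m} {xs : List (Fin m)} → Unique xs → length xs ≤ m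
Unique⇒length≤ u = injective⇒≤ (Unique-lookup-injective u)

covering⇒length≥ : ∀ {m} {xs : List (Fin m)} → (∀ z → z ∈ₗ xs) → m ≤ length xs
covering⇒length≥ {xs = xs} cov = injective⇒≤ {f = λ z → index (cov z)} λ {y} {z} eq →
  trans (lookup-index (cov y)) (trans (cong (lookup xs) eq) (sym (lookup-index (cov z))))

injective⇒≤∣p∣ : ∀ {k n} {g : Fin k → Fin n} {p : Subset n} →
                 Injective _≡_ _≡_ g → (∀ i → g i ∈ p) → k ≤ ∣ p ∣
injective⇒≤∣p∣ {zero}              _   _   = z≤n
injective⇒≤∣p∣ {suc k} {g = g} {p} inj g∈p = ≤-trans
  (s≤s (injective⇒≤∣p∣ {g = g ∘′ suc} {p - g zero} (suc-injective ∘′ inj)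
    (λ i → x∈p∧x≢y⇒x∈p-y (g∈p (suc i)) (λ eq → 0≢1+n (inj (sym eq))))))
  (x∈p⇒∣p-x∣<∣p∣ (g∈p zero))

injective∧≡∣p∣⇒surjective : ∀ {k n} {g : Fin k → Fin n} {p : Subset n} →
                            Injective _≡_ _≡_ g → (∀ i → g i ∈ p) → k ≡ ∣ p ∣ →
                            ∀ {v} → v ∈ p → ∃ λ i → g i ≡ v
injective∧≡∣p∣⇒surjective {k} {g = g} {p} inj g∈p k≡∣p∣ {v} v∈p with any? (λ i → g i ≟ v)
... | yes hit = hit
... | no  miss = ⊥-elim (1+n≰n (≤-trans (injective⇒≤∣p∣ {g = g′} inj′ g′∈p) (≤-reflexive (sym k≡∣p∣))))
  where
  g′ : Fin (suc k) → Fin _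
  g′ zero    = v
  g′ (suc i) = g i
  inj′ : Injective _≡_ _≡_ g′
  inj′ {zero}  {zero}  _ = refl
  inj′ {zero}  {suc j} e = ⊥-elim (miss (j , sym e))
  inj′ {suc i} {zero}  e = ⊥-elim (miss (i , e))
  inj′ {suc i} {suc j} e = cong suc (inj e)
  g′∈p : ∀ i → g′ i ∈ p
  g′∈p zero    = v∈p
  g′∈p (suc i) = g∈p i

min-satisfying : ∀ {m} (P : Fin m → Set) → Decidable P → (key : Fin m → ℕ) →
                 (∀ z → ¬ P z) ⊎ ∃ λ x → P x × (∀ z → P z → key x ≤ key z)
min-satisfying {zero}  P P? key = inj₁ λ ()
min-satisfying {suc m} P P? key
  with min-satisfying (λ z → P (suc z)) (λ z → P? (suc z)) (λ z → key (suc z)) | P? zero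
... | inj₁ none           | no ¬p₀ = inj₁ λ { zero p → ¬p₀ p ; (suc z) p → none z p }
... | inj₂ (x , px , min) | no ¬p₀ =
  inj₂ (suc x , px , λ { zero p → ⊥-elim (¬p₀ p) ; (suc z) p → min z p })
... | inj₁ none           | yes p₀ =
  inj₂ (zero , p₀ , λ { zero _ → ≤-refl ; (suc z) p → ⊥-elim (none z p) })
... | inj₂ (x , px , min) | yes p₀ with key zero ≤? key (suc x)
...   | yes k₀≤ = inj₂ (zero , p₀ , λ { zero _ → ≤-refl ; (suc z) p → ≤-trans k₀≤ (min z p) })
...   | no  k₀≰ = inj₂ (suc x , px , λ { zero _ → <⇒≤ (≰⇒> k₀≰) ; (suc z) p → min z p })

Unique-++-disjoint : ∀ {m} (xs : List (Fin m)) {ys z} → Unique (xs ++ ys) → z ∈ₗ xs → z ∉ₗ ys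
Unique-++-disjoint (x ∷ xs) (a ∷ _) (here refl) z∈ys = All.lookup a (∈-++⁺ʳ xs z∈ys) refl
Unique-++-disjoint (x ∷ xs) (_ ∷ u) (there z∈xs) z∈ys = Unique-++-disjoint xs u z∈xs z∈ys

module _ {m : ℕ} where

  EnumeratesRest : List (Fin m) → List (Fin m) → Set
  EnumeratesRest visited out =
    Unique out × All (_∉ₗ visited) out × (∀ z → z ∈ₗ out ⊎ z ∈ₗ visited)

  EnumeratesRest-[] : ∀ {visited} → (∀ z → z ∈ₗ visited) → EnumeratesRest visited []
  EnumeratesRest-[] all = [] , [] , λ z → inj₂ (all z)

  EnumeratesRest-∷ : ∀ {visited x out} → x ∉ₗ visited →
                     EnumeratesRest (x ∷ visited) out → EnumeratesRest visited (x ∷ out)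
  EnumeratesRest-∷ {visited} {x} {out} x∉ (u , fresh , cover) =
    ¬Any⇒All¬ out (λ x∈out → All.lookup fresh x∈out (here refl)) ∷ u ,
    x∉ ∷ All.map (λ z∉ → z∉ ∘′ there) fresh ,
    cover′
    where
    cover′ : ∀ z → z ∈ₗ x ∷ out ⊎ z ∈ₗ visited
    cover′ z with cover z
    ... | inj₁ z∈out         = inj₁ (there z∈out)
    ... | inj₂ (here z≡x)    = inj₁ (here z≡x)
    ... | inj₂ (there z∈vis) = inj₂ z∈vis

  EnumeratesRest-[]-length : ∀ {out} → EnumeratesRest [] out → length out ≡ m
  EnumeratesRest-[]-length (u , _ , cover) =
    ≤-antisym (Unique⇒length≤ u) (covering⇒length≥ λ z → [ id , (λ ()) ]′ (cover z))

module CycleTour {m : ℕ} (h : Fin m → Fin m) (h-inj : Injective _≡_ _≡_ h) (pos : Fin m → ℕ) where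

  open import Data.List.Membership.DecPropositional (_≟_ {m}) using (_∈?_)

  windows : Fin m → List (Fin m) → List (ℕ × ℕ)
  windows y []        = []
  windows y (y′ ∷ ys) = (pos (h y) , pos y′) ∷ windows y′ ys

  -- R is the orbit r, h r, …, y of r under h, listed backwards.
  data Run (r : Fin m) : Fin m → List (Fin m) → Set where
    start : Run r r (r ∷ [])
    step  : ∀ {y R} → Run r y R → Run r (h y) (h y ∷ R)

  Run-head : ∀ {r y R} → Run r y R → y ∈ₗ R
  Run-head start    = here refl
  Run-head (step _) = here refl

  Run-preimage : ∀ {r y R C z} → Run r y R → Unique (R ++ C) → h z ∈ₗ R → h z ≢ r → z ∈ₗ R × z ≢ y
  Run-preimage start _ (here hz≡r) hz≢r = ⊥-elim (hz≢r hz≡r)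
  Run-preimage (step run) (a ∷ _) (here hz≡hy) _ with h-inj hz≡hy
  ... | refl = there (Run-head run) , λ y≡hy → All.lookup a (∈-++⁺ˡ (Run-head run)) (sym y≡hy)
  Run-preimage (step run) (a ∷ u) (there hz∈R) hz≢r =
    let z∈R , _ = Run-preimage run u hz∈R hz≢r in
    there z∈R , λ z≡hy → All.lookup a (∈-++⁺ˡ z∈R) (sym z≡hy)

  record Invariant (closed R : List (Fin m)) (r y : Fin m) : Set where
    field
      run             : Run r y R
      unique          : Unique (R ++ closed)
      closed-preimage : ∀ {z} → h z ∈ₗ closed → z ∈ₗ closed
      below-root      : ∀ {z} → pos z < pos r → z ∈ₗ closed

  module _ {closed R r y} (inv : Invariant closed R r y) where
    open Invariant inv

    returns-to-root : h y ∈ₗ R ++ closed → h y ≡ r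
    returns-to-root hy∈ with ∈-++⁻ R hy∈
    ... | inj₂ hy∈closed =
      ⊥-elim (Unique-++-disjoint R unique (Run-head run) (closed-preimage hy∈closed))
    ... | inj₁ hy∈R with h y ≟ r
    ...   | yes hy≡r = hy≡r
    ...   | no  hy≢r = ⊥-elim (proj₂ (Run-preimage run unique hy∈R hy≢r) refl)

    root-below-fresh : ∀ {x} → x ∉ₗ R ++ closed → pos r ≤ pos x
    root-below-fresh {x} x∉ with pos r ≤? pos x
    ... | yes r≤x = r≤x
    ... | no  r≰x = ⊥-elim (x∉ (∈-++⁺ʳ R (below-root (≰⇒> r≰x))))

    Invariant-step : h y ∉ₗ R ++ closed → Invariant closed (h y ∷ R) r (h y)
    Invariant-step hy∉ = record
      { run = step run ; unique = ¬Any⇒All¬ _ hy∉ ∷ unique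
      ; closed-preimage = closed-preimage ; below-root = below-root }

    Invariant-restart : h y ≡ r → ∀ {x} → x ∉ₗ R ++ closed → (∀ z → z ∉ₗ R ++ closed → pos x ≤ pos z) →
                        Invariant (R ++ closed) (x ∷ []) x x
    Invariant-restart hy≡r {x} x∉ x-min = record
      { run = start ; unique = ¬Any⇒All¬ _ x∉ ∷ unique
      ; closed-preimage = preimage ; below-root = below }
      where
      preimage : ∀ {z} → h z ∈ₗ R ++ closed → z ∈ₗ R ++ closed
      preimage {z} hz∈ with ∈-++⁻ R hz∈
      ... | inj₂ hz∈closed = ∈-++⁺ʳ R (closed-preimage hz∈closed)
      ... | inj₁ hz∈R with h z ≟ r
      ...   | no  hz≢r = ∈-++⁺ˡ (proj₁ (Run-preimage run unique hz∈R hz≢r))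
      ...   | yes hz≡r with h-inj (trans hz≡r (sym hy≡r))
      ...     | refl = ∈-++⁺ˡ (Run-head run)
      below : ∀ {z} → pos z < pos x → z ∈ₗ R ++ closed
      below {z} z<x with z ∈? R ++ closed
      ... | yes z∈ = z∈
      ... | no  z∉ = ⊥-elim (<⇒≱ z<x (x-min z z∉))

  Tour : List (Fin m) → Fin m → Fin m → Set
  Tour visited r y = ∃ λ out → EnumeratesRest visited out × NonOverlappingFrom (pos r) (windows y out)

  tourFrom : ∀ fuel {closed R r y} → Invariant closed R r y → m ≤ length (R ++ closed) + fuel →
             Tour (R ++ closed) r y
  tourFrom zero {closed} {R} inv enough = [] , EnumeratesRest-[] visited , tt
    where
    visited : ∀ z → z ∈ₗ R ++ closed
    visited z with z ∈? R ++ closed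
    ... | yes z∈ = z∈
    ... | no  z∉ = ⊥-elim (1+n≰n (≤-trans (Unique⇒length≤ (¬Any⇒All¬ _ z∉ ∷ Invariant.unique inv))
                                          (≤-trans enough (≤-reflexive (+-identityʳ _)))))
  tourFrom (suc k) {closed} {R} {r} {y} inv enough with h y ∈? R ++ closed
  ... | no hy∉ =
    let out , rest , ch = tourFrom k (Invariant-step inv hy∉) enough′ in
    h y ∷ out , EnumeratesRest-∷ hy∉ rest , inj₁ (refl , ch)
    where
    enough′ : m ≤ suc (length (R ++ closed) + k)
    enough′ = ≤-trans enough (≤-reflexive (+-suc _ k))
  ... | yes hy∈ with min-satisfying (_∉ₗ R ++ closed) (λ z → ¬? (z ∈? R ++ closed)) pos
  ...   | inj₁ none = [] , EnumeratesRest-[] (λ z → decidable-stable (z ∈? R ++ closed) (none z)) , tt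
  ...   | inj₂ (x , x∉ , x-min) =
    let out , rest , ch = tourFrom k (Invariant-restart inv hy≡r x∉ x-min) enough′ in
    x ∷ out , EnumeratesRest-∷ x∉ rest , inj₂ (≤-reflexive (cong pos (sym hy≡r)) , hy≤x , ch)
    where
    enough′ : m ≤ suc (length (R ++ closed) + k)
    enough′ = ≤-trans enough (≤-reflexive (+-suc _ k))
    hy≡r : h y ≡ r
    hy≡r = returns-to-root inv hy∈
    hy≤x : pos (h y) ≤ pos x
    hy≤x = subst (λ t → pos t ≤ pos x) (sym hy≡r) (root-below-fresh inv x∉)

  cycleTour : Fin m → ∃ λ y₀ → ∃ λ out →
              Unique (y₀ ∷ out) × length (y₀ ∷ out) ≡ m × NonOverlappingFrom (pos y₀) (windows y₀ out)
  cycleTour z with min-satisfying (λ _ → ⊤) (λ _ → yes tt) pos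
  ... | inj₁ none         = ⊥-elim (none z tt)
  ... | inj₂ (r , _ , r-min) =
    let out , rest , ch = tourFrom m initial (n≤1+n m)
        enum = EnumeratesRest-∷ (λ ()) rest
    in r , out , proj₁ enum , EnumeratesRest-[]-length enum , ch
    where
    initial : Invariant [] (r ∷ []) r r
    initial = record
      { run = start ; unique = [] ∷ []
      ; closed-preimage = λ () ; below-root = λ z<r → ⊥-elim (<⇒≱ z<r (r-min _ tt)) }

module _ {n q : ℕ} (E : Digraph n) {F : Fin q → List (Fin n)} (F-unique : ∀ i → Unique (F i))
         (F-disjoint : ∀ {i j} → i ≢ j → Disjoint E (F i) (F j)) where

  private
    countSum : Fin n → List (Fin q) → ℕ
    countSum v zs = sum (map (λ z → count v (F z)) zs)

    countSum-absent : ∀ v zs → (∀ {z} → z ∈ₗ zs → v ∉ₗ F z) → countSum v zs ≡ 0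
    countSum-absent v []       _      = refl
    countSum-absent v (z ∷ zs) absent
      rewrite count-∉ (F z) (absent (here refl)) = countSum-absent v zs (absent ∘′ there)

  open import Data.List.Membership.DecPropositional (_≟_ {n}) using (_∈?_)

  disjoint-countSum≤1 : ∀ v {zs} → Unique zs → sum (map (λ z → count v (F z)) zs) ≤ 1
  disjoint-countSum≤1 v {[]}     _       = z≤n
  disjoint-countSum≤1 v {z ∷ zs} (a ∷ u) with v ∈? F z
  ... | yes v∈Fz rewrite countSum-absent v zs (λ z′∈ → F-disjoint (All.lookup a z′∈) v∈Fz) =
    ≤-trans (≤-reflexive (+-identityʳ _)) (Unique⇒count≤1 v (F-unique z))
  ... | no  v∉Fz rewrite count-∉ (F z) v∉Fz = disjoint-countSum≤1 v u

module Linkage {n : ℕ} (G : Digraph n) {Z S T : Subset n} {𝓛 : List (List (Fin n))}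
               (linkage : IsLinkageAvoiding G Z S T 𝓛) where

  private
    V = Fin n

    ∣S∣≡∣T∣ : ∣ S ∣ ≡ ∣ T ∣
    ∣S∣≡∣T∣ = let e , _ , _ , _ = linkage in e

  length≡∣S∣ : length 𝓛 ≡ ∣ S ∣
  length≡∣S∣ = let _ , e , _ , _ = linkage in e

  path : Fin (length 𝓛) → List V
  path = lookup 𝓛

  private
    property : ∀ l → IsPathAvoiding G Z (path l) × StartsIn G S (path l) × EndsIn G T (path l)
    property l = let _ , _ , ps , _ = linkage in All.lookup ps (∈-lookup l)

  path-isPath : ∀ l → IsPath G (path l)
  path-isPath l = proj₁ (proj₁ (property l))

  path-disjoint : ∀ {l l′} → l ≢ l′ → Disjoint G (path l) (path l′)
  path-disjoint = let _ , _ , _ , ds = linkage in AllPairs-lookup Disjoint-sym ds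
    where
    Disjoint-sym : Symmetric (Disjoint G)
    Disjoint-sym d q p = d p q

  start end : Fin (length 𝓛) → V
  start l = proj₁ (proj₁ (proj₂ (property l)))
  end   l = proj₁ (proj₂ (proj₂ (property l)))

  start-head : ∀ l → head (path l) ≡ just (start l)
  start-head l = proj₁ (proj₂ (proj₁ (proj₂ (property l))))

  start∈ : ∀ l → start l ∈ S
  start∈ l = proj₂ (proj₂ (proj₁ (proj₂ (property l))))

  end-last : ∀ l → last (path l) ≡ just (end l)
  end-last l = proj₁ (proj₂ (proj₂ (proj₂ (property l))))

  end∈ : ∀ l → end l ∈ T
  end∈ l = proj₂ (proj₂ (proj₂ (proj₂ (property l))))

  private
    on-path-injective : (e : Fin (length 𝓛) → V) → (∀ l → e l ∈ₗ path l) → Injective _≡_ _≡_ e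
    on-path-injective e e∈ {l} {l′} eq with l ≟ l′
    ... | yes l≡l′ = l≡l′
    ... | no  l≢l′ = ⊥-elim (path-disjoint l≢l′ (e∈ l) (subst (_∈ₗ path l′) (sym eq) (e∈ l′)))

  end-injective : Injective _≡_ _≡_ end
  end-injective = on-path-injective end λ l → last∈ (path l) (end-last l)

  starts-everywhere : ∀ {v} → v ∈ S → ∃ λ l → start l ≡ v
  starts-everywhere = injective∧≡∣p∣⇒surjective
    (on-path-injective start λ l → head∈ (path l) (start-head l)) start∈ length≡∣S∣

  reordered : ∀ {q} {σ : Fin q → Fin (length 𝓛)} → Injective _≡_ _≡_ σ →
              ∀ {ys} → Unique ys → length ys ≡ length 𝓛 → IsLinkage G S T (map (path ∘′ σ) ys)
  reordered {σ = σ} σ-inj {ys} u len =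
    ∣S∣≡∣T∣ ,
    trans (length-map (path ∘′ σ) ys) (trans len length≡∣S∣) ,
    All-map⁺ (All.universal (λ y → let (p , _) , s , t = property (σ y) in
                                   (p , All.universal (λ _ → ∉⊥) _) , s , t) ys) ,
    AllPairs.map⁺ (AllPairs.map (λ y≢y′ {_} → path-disjoint (y≢y′ ∘′ σ-inj)) u)

⊆⋃ : ∀ {n} {p : Subset n} {ps} → p ∈ₗ ps → p ⊆ ⋃ ps
⊆⋃ {ps = q ∷ ps} (here refl) = p⊆p∪q (⋃ ps)
⊆⋃ {ps = q ∷ ps} (there p∈)  = q⊆p∪q q (⋃ ps) ∘′ ⊆⋃ p∈

count≤⇒OverlapAtMost : ∀ {n k} (W : List (Fin n)) → (∀ v → count v W ≤ k) → OverlapAtMost k W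
count≤⇒OverlapAtMost W bound v = (λ _ _ → ≤-trans (m∸n≤m _ 1) (bound v)) , (λ _ → bound v)

module FromPathSystem {n : ℕ} (G : Digraph n) {a b : ℕ} (1≤b : 1 ≤ b)
                      {P : Fin a → List (Fin n)} {A B : Fin a → Subset n}
                      (system : IsPathSystem G a b P A B) (i j : Fin a) where

  private
    V = Fin n

    P-path : ∀ k → IsPath G (P k)
    P-path = let p , _ , _ , _ , _ = system in p

    ∣A∣≡b : ∀ k → ∣ A k ∣ ≡ b
    ∣A∣≡b k = let _ , _ , s , _ , _ = system in proj₁ (s k)

    ∣B∣≡b : ∀ k → ∣ B k ∣ ≡ b
    ∣B∣≡b k = let _ , _ , s , _ , _ = system in proj₂ (s k)

    A⊆P : ∀ k {v} → v ∈ A k → v ∈ₗ P k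
    A⊆P k v∈ = let _ , _ , _ , o , _ = system
                   _ , _ , P≡ , A⊆pre , _ = o k
               in subst (_ ∈ₗ_) (sym P≡) (∈-++⁺ˡ (A⊆pre _ v∈))

    terminals : Fin a → Subset n
    terminals k = A k ∪ B k

    X : Subset n
    X = ⋃ (map terminals (allFin a))

    terminals⊆X : ∀ k → terminals k ⊆ X
    terminals⊆X k = ⊆⋃ (∈-map⁺ terminals (∈-allFin k))

    forward : ∃ (IsLinkageAvoiding G (X ─ (B i ∪ A j)) (B i) (A j))
    forward = let _ , _ , _ , _ , wl = system in
      wl (B i) (A j) (terminals⊆X i ∘′ q⊆p∪q (A i) (B i)) (terminals⊆X j ∘′ p⊆p∪q (B j))
         (trans (∣B∣≡b i) (sym (∣A∣≡b j)))

    backward : ∃ (IsLinkageAvoiding G (X ─ (A j ∪ B i)) (A j) (B i))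
    backward = let _ , _ , _ , _ , wl = system in
      wl (A j) (B i) (terminals⊆X j ∘′ p⊆p∪q (B j)) (terminals⊆X i ∘′ q⊆p∪q (A i) (B i))
         (trans (∣A∣≡b j) (sym (∣B∣≡b i)))

  module L = Linkage G (proj₂ forward)
  module M = Linkage G (proj₂ backward)

  private
    m : ℕ
    m = length (proj₁ backward)

  f : Fin m → Fin (length (proj₁ forward))
  f x = proj₁ (L.starts-everywhere (M.end∈ x))

  f-spec : ∀ x → L.start (f x) ≡ M.end x
  f-spec x = proj₂ (L.starts-everywhere (M.end∈ x))

  g : Fin (length (proj₁ forward)) → Fin m
  g l = proj₁ (M.starts-everywhere (L.end∈ l))

  g-spec : ∀ l → M.start (g l) ≡ L.end l
  g-spec l = proj₂ (M.starts-everywhere (L.end∈ l))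

  f-injective : Injective _≡_ _≡_ f
  f-injective {x} {x′} eq =
    M.end-injective (trans (sym (f-spec x)) (trans (cong L.start eq) (f-spec x′)))

  g-injective : Injective _≡_ _≡_ g
  g-injective {l} {l′} eq =
    L.end-injective (trans (sym (g-spec l)) (trans (cong M.start eq) (g-spec l′)))

  h : Fin m → Fin m
  h = g ∘′ f

  h-injective : Injective _≡_ _≡_ h
  h-injective = f-injective ∘′ g-injective

  pos : Fin m → ℕ
  pos x = toℕ (index (A⊆P j (M.start∈ x)))

  pos-head : ∀ x → head (drop (pos x) (P j)) ≡ just (M.start x)
  pos-head x = head-drop-index (A⊆P j (M.start∈ x))

  F : Fin m → List V
  F y = L.path (f y)

  -- The thread out of F y starts where the M-path h y starts, runs along P j to the start of the
  -- M-path y′ and follows it to the start of F y′.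
  Q : Fin m → Fin m → List V
  Q y y′ = loopErase (segment (P j) (pos (h y)) (pos y′) ++ tail′ (M.path y′))

  open ThreadedWalk G F Q
  open CycleTour h h-injective pos

  thread : ∀ {y y′} → pos (h y) ≤ pos y′ → IsThread y y′
  thread {y} {y′} h≤y′ =
    (Consecutive⇒IsWalk G (Q y y′) Q-consecutive Q-head , loopErase-unique w) , e₁ , e₂
    where
    seg w : List V
    seg = segment (P j) (pos (h y)) (pos y′)
    w   = seg ++ tail′ (M.path y′)

    seg-walk : IsWalk G seg
    seg-walk = Consecutive⇒IsWalk G seg
      (segment-consecutive (P j) G (pos (h y)) (pos y′)
        (IsWalk⇒Consecutive G (P j) (proj₁ (P-path j))))
      (segment-head (P j) (pos (h y)) (pos y′) (pos-head (h y)))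

    seg-last : last seg ≡ head (M.path y′)
    seg-last = trans (segment-last (P j) h≤y′ (pos-head y′)) (sym (M.start-head y′))

    Q-head : head (Q y y′) ≡ just (M.start (h y))
    Q-head = trans (loopErase-head w) (trans (IsWalk-head-++ G seg _ seg-walk)
      (segment-head (P j) (pos (h y)) (pos y′) (pos-head (h y))))

    Q-consecutive : Consecutive G (Q y y′)
    Q-consecutive = loopErase-consecutive G w (Consecutive-++-tail′ G seg (M.path y′)
      (IsWalk⇒Consecutive G seg seg-walk)
      (IsWalk⇒Consecutive G (M.path y′) (proj₁ (M.path-isPath y′))) seg-last)

    e₁ : last (F y) ≡ head (Q y y′)
    e₁ = begin
      last (F y)              ≡⟨ L.end-last (f y) ⟩
      just (L.end (f y))      ≡⟨ cong just (g-spec (f y)) ⟨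
      just (M.start (h y))    ≡⟨ Q-head ⟨
      head (Q y y′)           ∎
      where open ≡-Reasoning

    e₂ : last (Q y y′) ≡ head (F y′)
    e₂ = begin
      last (Q y y′)           ≡⟨ loopErase-last w ⟩
      last w                  ≡⟨ last-++-tail′ seg (M.path y′) seg-last ⟩
      last (M.path y′)        ≡⟨ M.end-last y′ ⟩
      just (M.end y′)         ≡⟨ cong just (f-spec y′) ⟨
      just (L.start (f y′))   ≡⟨ L.start-head (f y′) ⟨
      head (F y′)             ∎
      where open ≡-Reasoning

  threads : ∀ lo y ys → NonOverlappingFrom lo (windows y ys) → Linked IsThread (y ∷ ys)
  threads lo y []        _                   = [-]
  threads lo y (y′ ∷ ys) (inj₁ (eq , ch))    = thread (≤-reflexive eq) ∷ threads lo y′ ys ch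
  threads lo y (y′ ∷ ys) (inj₂ (_ , le , ch)) = thread le ∷ threads (pos y′) y′ ys ch

  threadCount≤ : ∀ v y ys → threadCount v y ys ≤
                 windowCount (P j) v (windows y ys) + sum (map (λ z → count v (M.path z)) ys)
  threadCount≤ v y []        = z≤n
  threadCount≤ v y (y′ ∷ ys) =
    ≤-trans (+-mono-≤ Q-count (threadCount≤ v y′ ys)) (≤-reflexive (interchange
      (count v (tail′ seg)) (count v (M.path y′))
      (windowCount (P j) v (windows y′ ys)) (sum (map (λ z → count v (M.path z)) ys))))
    where
    seg : List V
    seg = segment (P j) (pos (h y)) (pos y′)
    Q-count : count v (tail′ (Q y y′)) ≤ count v (tail′ seg) + count v (M.path y′)
    Q-count = ≤-trans (loopErase-count-tail′ v (seg ++ tail′ (M.path y′)))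
      (≤-trans (count-tail′-++ v seg (tail′ (M.path y′))) (+-monoʳ-≤ _ (count-tail′ v (M.path y′))))

  private
    m≡b : m ≡ b
    m≡b = trans M.length≡∣S∣ (∣A∣≡b j)

    tour : ∃ λ y₀ → ∃ λ out → Unique (y₀ ∷ out) × length (y₀ ∷ out) ≡ m ×
                              NonOverlappingFrom (pos y₀) (windows y₀ out)
    tour = cycleTour (subst Fin (sym m≡b) (fromℕ< 1≤b))

  y₀ : Fin m
  y₀ = proj₁ tour

  out : List (Fin m)
  out = proj₁ (proj₂ tour)

  private
    tour-unique : Unique (y₀ ∷ out)
    tour-unique = let u , _ , _ = proj₂ (proj₂ tour) in u

    tour-length : length (y₀ ∷ out) ≡ m
    tour-length = let _ , len , _ = proj₂ (proj₂ tour) in len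

    tour-windows : NonOverlappingFrom (pos y₀) (windows y₀ out)
    tour-windows = let _ , _ , ch = proj₂ (proj₂ tour) in ch

  𝓛 : List (List V)
  𝓛 = map F (y₀ ∷ out)

  W : List V
  W = weave y₀ out

  𝓛-length : length 𝓛 ≡ b
  𝓛-length = trans (length-map F (y₀ ∷ out)) (trans tour-length m≡b)

  𝓛-linkage : IsLinkage G (B i) (A j) 𝓛
  𝓛-linkage = L.reordered f-injective tour-unique
    (trans tour-length (trans m≡b (sym (trans L.length≡∣S∣ (∣B∣≡b i)))))

  W-threaded : IsThreadedLinkage G W 𝓛
  W-threaded = weave-walk F-walk y₀ out linked , weave-threaded y₀ out linked
    where
    F-walk : ∀ y → IsWalk G (F y)
    F-walk y = proj₁ (L.path-isPath (f y))
    linked : Linked IsThread (y₀ ∷ out)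
    linked = threads (pos y₀) y₀ out tour-windows

  W-count≤3 : ∀ v → count v W ≤ 3
  W-count≤3 v = begin
    count v W
      ≤⟨ weave-count v y₀ out ⟩
    sum (map (λ z → count v (F z)) (y₀ ∷ out)) + threadCount v y₀ out
      ≤⟨ +-mono-≤ L-count (threadCount≤ v y₀ out) ⟩
    1 + (windowCount (P j) v (windows y₀ out) + sum (map (λ z → count v (M.path z)) out))
      ≤⟨ +-monoʳ-≤ 1 (+-mono-≤ P-count M-count) ⟩
    3 ∎
    where
    open ≤-Reasoning
    L-count : sum (map (λ z → count v (F z)) (y₀ ∷ out)) ≤ 1
    L-count = disjoint-countSum≤1 G (λ y → proj₂ (L.path-isPath (f y)))
                (λ y≢y′ → L.path-disjoint (y≢y′ ∘′ f-injective)) v tour-unique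
    M-count : sum (map (λ z → count v (M.path z)) out) ≤ 1
    M-count = disjoint-countSum≤1 G (λ x → proj₂ (M.path-isPath x)) M.path-disjoint v
                (AllPairs.tail tour-unique)
    P-count : windowCount (P j) v (windows y₀ out) ≤ 1
    P-count = ≤-trans (windowCount-nonOverlapping (P j) v (pos y₀) (windows y₀ out) tour-windows)
                (≤-trans (count-drop v (suc (pos y₀)) (P j)) (Unique⇒count≤1 v (proj₂ (P-path j))))

mainTheorem5 : ∀ {n : ℕ} (G : Digraph n) (a b : ℕ) → 1 ≤ a → 1 ≤ b →
    (P : Fin a → List (Fin n)) (A B : Fin a → Subset n) →
    IsPathSystem G a b P A B →
    ∀ (i j : Fin a) → ∃[ 𝓛 ] ∃[ W ]
    (IsLinkage G (B i) (A j) 𝓛 × IsThreadedLinkage G W 𝓛 ×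
    length 𝓛 ≡ b × OverlapAtMost 3 W)
mainTheorem5 G a b _ 1≤b P A B system i j =
  𝓛 , W , 𝓛-linkage , W-threaded , 𝓛-length , count≤⇒OverlapAtMost W W-count≤3
  where open FromPathSystem G 1≤b system i j
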